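{- Let $\mathcal{A}$ be a non-empty finite set of agents and $\mathcal{P}$ a non-empty countable set of atoms. For every formula $\varphi$ of action model logic there exists a formula $\varphi'$ of action formula logic such that for every pointed Kripke model $(M,w)$: $M,w\models\varphi$ (action model logic semantics) if and only if $M,w\models\varphi'$ (action formula logic semantics over $\mathcal{K}$).
   Context: Kripke models $M=(S,R,V)$: non-empty $S$, $R_a\subseteq S\times S$ per agent, $V:\mathcal{P}\to2^S$; $\mathcal{K}$ is the class of all of them. Action models $\mathsf{M}=(\mathsf{S},\to,\mathsf{pre})$: finite non-empty $\mathsf{S}$, relations $\to_a$, preconditions; multi-pointed $(\mathsf{M},\mathsf{T})$. Action model logic formulas: $\varphi::=p\mid\neg\varphi\mid(\varphi\wedge\varphi)\mid\Box_a\varphi\mid[\mathsf{M},\mathsf{T}]\varphi$ (preconditions themselves such formulas). Execution $M\otimes\mathsf{M}$: states $(w,e)$ with $M,w\models\mathsf{pre}(e)$, $(w,e)R'_a(v,f)$ iff $wR_av$ and $e\to_af$, valuation from $w$; $(M,w)\otimes(\mathsf{M},\mathsf{T})=(M\otimes\mathsf{M},(\{w\}\times\mathsf{T})\cap S')$; truth at a set = truth at all its members; $M,w\models[\mathsf{M},\mathsf{T}]\varphi$ iff $(M,w)\otimes(\mathsf{M},\mathsf{T})\models\varphi$; $\Box_a$ and Booleans as usual; $\langle\mathsf{M},e\rangle=\neg[\mathsf{M},\{e\}]\neg$. Sequential composition $(\mathsf{M},\mathsf{T})\otimes(\mathsf{M}',\mathsf{T}')$: domain $\mathsf{S}\times\mathsf{S}'$,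 componentwise relations, $\mathsf{pre}((e,e'))=\langle\mathsf{M},e\rangle\mathsf{pre}'(e')$, designated $\mathsf{T}\times\mathsf{T}'$. Action formula logic: $\psi::=p\mid\neg\psi\mid(\psi\wedge\psi)\mid\Box_a\psi\mid[\alpha]\psi$, $\alpha::=?\psi\mid\alpha\cup\alpha\mid\alpha;\alpha\mid L_B(\alpha,\alpha)$, $\emptyset\ne B\subseteq\mathcal{A}$; $M,w\models[\alpha]\psi$ iff $(M,w)\otimes\tau(\alpha)\models\psi$, where $\tau$ is: $\tau(?\psi)$: points $t,s$, $\to_a=\{(t,s),(s,s)\}$ for all $a$, $\mathsf{pre}(t)=\psi$, $\mathsf{pre}(s)=\top$, designated $\{t\}$; $\tau(\alpha\cup\beta)$: disjoint union with designated sets united; $\tau(\alpha;\beta)=\tau(\alpha)\otimes\tau(\beta)$; for $\tau(\alpha)=((\mathsf{S}^\alpha,\to^\alpha,\mathsf{pre}^\alpha),\mathsf{T}^\alpha)$, $\tau(L_B(\alpha,\alpha))$ has domain $\mathsf{S}^\alpha\cup\{t,s\}$ (new), $\to_a=\to^\alpha_a\cup\{(s,s)\}\cup\{(t,u)\mid u\in\mathsf{T}^\alpha\}$ for $a\in B$, $\to_a=\to^\alpha_a\cup\{(t,s),(s,s)\}$ for $a\notin B$, $\mathsf{pre}(t)=\mathsf{pre}(s)=\top$, designated $\{t\}$; $\tau(L_B(\alpha,\beta))=\tau(L_B(\alpha\cup\beta,\alpha\cup\beta))$. -}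

module Defs where

open import Data.Nat using (ℕ; suc)
open import Data.Fin using (Fin)
open import Data.Fin.Subset using (Subset; Nonempty; _∈_; _∉_)
open import Data.Bool using (Bool; true; false)
open import Data.Product using (Σ; _×_; _,_)
open import Data.Sum using (_⊎_; inj₁; inj₂)
open import Data.Unit using (⊤)
open import Data.Empty using (⊥)
open import Relation.Binary.PropositionalEquality using (_≡_)
open import Relation.Nullary using (¬_)

module Logic (nA : ℕ) (P : Set) where

  Agent : Set
  Agent = Fin (suc nA)

  -- Kripke structures (truth is Set-valued; classical metatheory is
  -- supplied by an excluded-middle hypothesis in the statement).
  -- Non-emptiness of the domain is automatic for pointed models.
  record KStruct : Set₁ where
    field
      St : Set
      R  : Agent → St → St → Set
      V  : P → St → Set
  open KStruct public

  -- Semantic action models: preconditions are given by their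
  -- semantic extension on every Kripke structure.  Used as the common
  -- target of both logics' action-model syntax.
  record SAM : Set₁ where
    field
      E   : Set
      arr : Agent → E → E → Set
      pre : (M : KStruct) → St M → E → Set
      Des : E → Set
  open SAM public

  exec : KStruct → SAM → KStruct
  exec M A = record
    { St = Σ (St M × E A) (λ { (v , e) → pre A M v e })
    ; R  = λ { a ((v , e) , _) ((u , f) , _) → R M a v u × arr A a e f }
    ; V  = λ { p ((v , _) , _) → V M p v }
    }

  boxSem : (M : KStruct) → St M → (A : SAM) → (D : E A → Set) →
           (St (exec M A) → Set) → Set
  boxSem M w A D Q = ∀ e → D e → (h : pre A M w e) → Q ((w , e) , h)

  mutual
    data Form : Set where
      atom : P → Form
      ¬ᶠ_  : Form → Form
      _∧ᶠ_ : Form → Form → Form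
      □    : Agent → Form → Form
      [_,_]_ : ∀ {k} → ActionModel k → Subset (suc k) → Form → Form

    data ActionModel (k : ℕ) : Set where
      actionModel : (rel : Agent → Fin (suc k) → Fin (suc k) → Bool)
                    (pre : Fin (suc k) → Form) → ActionModel k

  mutual
    _,_⊨_ : (M : KStruct) → St M → Form → Set
    M , w ⊨ atom p = V M p w
    M , w ⊨ (¬ᶠ φ) = ¬ (M , w ⊨ φ)
    M , w ⊨ (φ ∧ᶠ ψ) = (M , w ⊨ φ) × (M , w ⊨ ψ)
    M , w ⊨ □ a φ = ∀ v → R M a w v → M , v ⊨ φ
    M , w ⊨ ([ 𝖬 , T ] φ) =
      boxSem M w (toSAM 𝖬 T) (Des (toSAM 𝖬 T)) (λ s → exec M (toSAM 𝖬 T) , s ⊨ φ)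

    toSAM : ∀ {k} → ActionModel k → Subset (suc k) → SAM
    toSAM {k} (actionModel rel pr) T = record
      { E   = Fin (suc k)
      ; arr = λ a e f → rel a e f ≡ true
      ; pre = λ M w e → M , w ⊨ pr e
      ; Des = λ e → e ∈ T
      }

  mutual
    data AForm : Set where
      atom : P → AForm
      ¬ᶠ_  : AForm → AForm
      _∧ᶠ_ : AForm → AForm → AForm
      □    : Agent → AForm → AForm
      [_]_ : Act → AForm → AForm

    data Act : Set where
      ¿_   : AForm → Act
      _∪ᵃ_ : Act → Act → Act
      _⨾_  : Act → Act → Act
      L    : (B : Subset (suc nA)) → Nonempty B → Act → Act → Act

  -- two-point test model: true = t, false = s
  testArr : Agent → Bool → Bool → Set
  testArr _ _ f = f ≡ false

  unionSAM : SAM → SAM → SAM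
  unionSAM A C = record
    { E   = E A ⊎ E C
    ; arr = λ { a (inj₁ e) (inj₁ f) → arr A a e f
              ; a (inj₂ e) (inj₂ f) → arr C a e f
              ; a (inj₁ _) (inj₂ _) → ⊥
              ; a (inj₂ _) (inj₁ _) → ⊥ }
    ; pre = λ { M w (inj₁ e) → pre A M w e ; M w (inj₂ e) → pre C M w e }
    ; Des = λ { (inj₁ e) → Des A e ; (inj₂ e) → Des C e }
    }

  diamondSem : (M : KStruct) → St M → (A : SAM) → E A →
               (St (exec M A) → Set) → Set
  diamondSem M w A e Q = ¬ boxSem M w A (λ f → f ≡ e) (λ s → ¬ Q s)

  compSAM : SAM → SAM → SAM
  compSAM A C = record
    { E   = E A × E C
    ; arr = λ { a (e , e') (f , f') → arr A a e f × arr C a e' f' }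
    ; pre = λ { M w (e , e') → diamondSem M w A e (λ s → pre C (exec M A) s e') }
    ; Des = λ { (e , e') → Des A e × Des C e' }
    }

  -- τ(L_B(α,α)) built from A = τ(α); new points t = inj₂ true, s = inj₂ false
  LArr : Subset (suc nA) → (A : SAM) → Agent → E A ⊎ Bool → E A ⊎ Bool → Set
  LArr B A a (inj₁ e) (inj₁ f) = arr A a e f
  LArr B A a (inj₁ _) (inj₂ _) = ⊥
  LArr B A a (inj₂ false) (inj₂ false) = ⊤
  LArr B A a (inj₂ false) (inj₂ true) = ⊥
  LArr B A a (inj₂ false) (inj₁ _) = ⊥
  LArr B A a (inj₂ true) (inj₁ u) = a ∈ B × Des A u
  LArr B A a (inj₂ true) (inj₂ false) = a ∉ B
  LArr B A a (inj₂ true) (inj₂ true) = ⊥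

  LSAM : Subset (suc nA) → SAM → SAM
  LSAM B A = record
    { E   = E A ⊎ Bool
    ; arr = LArr B A
    ; pre = λ { M w (inj₁ e) → pre A M w e ; M w (inj₂ _) → ⊤ }
    ; Des = λ x → x ≡ inj₂ true
    }

  mutual
    _,_⊨ᶠ_ : (M : KStruct) → St M → AForm → Set
    M , w ⊨ᶠ atom p = V M p w
    M , w ⊨ᶠ (¬ᶠ φ) = ¬ (M , w ⊨ᶠ φ)
    M , w ⊨ᶠ (φ ∧ᶠ ψ) = (M , w ⊨ᶠ φ) × (M , w ⊨ᶠ ψ)
    M , w ⊨ᶠ □ a φ = ∀ v → R M a w v → M , v ⊨ᶠ φ
    M , w ⊨ᶠ ([ α ] φ) =
      boxSem M w (τ α) (Des (τ α)) (λ s → exec M (τ α) , s ⊨ᶠ φ)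

    τ : Act → SAM
    τ (¿ ψ) = record
      { E   = Bool
      ; arr = testArr
      ; pre = λ { M w true → M , w ⊨ᶠ ψ ; M w false → ⊤ }
      ; Des = λ e → e ≡ true
      }
    τ (α ∪ᵃ β) = unionSAM (τ α) (τ β)
    τ (α ⨾ β)  = compSAM (τ α) (τ β)
    τ (L B _ α β) = LSAM B (unionSAM (τ α) (τ β))   -- = τ(L_B(α∪β,α∪β))

-- Both logics are exactly as expressive as basic modal logic.  An action-model
-- formula is reduced to a modal one by the reduction axioms
--   [𝖬,e]χ ↔ (pre e → ⟨reduct of χ at e⟩),   [𝖬,e]□ₐχ ↔ (pre e → ⋀_{e →ₐ f} □ₐ[𝖬,f]χ),
-- with Boolean connectives commuting with the reduct, and the modal formula is
-- then read as a test-free formula of action formula logic.  The intermediate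
-- modal language has implication and finite conjunction so that the reduction
-- is constructively sound; only the final rendering of → by ¬ and ∧ is classical.
module Submission where

open import Defs
open import Data.Nat using (ℕ; zero; suc)
open import Data.Fin using (Fin; zero; suc)
open import Data.Fin.Subset using (Subset)
open import Data.Vec using (lookup)
open import Data.Vec.Properties using ([]=⇒lookup; lookup⇒[]=)
open import Data.Bool using (Bool; true; false)
open import Data.Product using (Σ; _×_; _,_)
open import Data.Product.Function.NonDependent.Propositional using (_×-⇔_)
open import Relation.Binary.PropositionalEquality using (_≡_; refl)
open import Relation.Nullary using (¬_)
open import Relation.Nullary.Negation using (Stable)
open import Relation.Nullary.Decidable using (decidable-stable)
open import Function using (_∘_)
open import Function.Bundles using (_↣_; _⇔_; mk⇔; Equivalence)
open import Function.Construct.Identity using (⇔-id)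
open import Function.Properties.Equivalence using () renaming (sym to ⇔-sym; trans to ⇔-trans)
open import Function.Related.TypeIsomorphisms using (→-cong-⇔; ¬-cong-⇔)
open import Axiom.ExcludedMiddle using (ExcludedMiddle)
open import Level using (0ℓ)

open Equivalence using (to; from)

Π-cong-⇔ : {I : Set} {A B : I → Set} → (∀ i → A i ⇔ B i) → (∀ i → A i) ⇔ (∀ i → B i)
Π-cong-⇔ A⇔B = mk⇔ (λ f i → to (A⇔B i) (f i)) (λ g i → from (A⇔B i) (g i))

→-Π-cong-⇔ : {A B C : Set} {D : B → Set} →
             A ⇔ B → ((b : B) → C ⇔ D b) → (A → C) ⇔ ((b : B) → D b)
→-Π-cong-⇔ A⇔B C⇔D = mk⇔
  (λ f b → to (C⇔D b) (f (from A⇔B b)))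
  (λ g a → from (C⇔D (to A⇔B a)) (g (to A⇔B a)))

stable⇒→⇔¬×¬ : {A B : Set} → Stable B → (A → B) ⇔ (¬ (A × ¬ B))
stable⇒→⇔¬×¬ stable = mk⇔ (λ f (a , ¬b) → ¬b (f a)) (λ ¬a×¬b a → stable (λ ¬b → ¬a×¬b (a , ¬b)))

module _ (nA : ℕ) (P : Set) where
  open Logic nA P

  infix  5 ¬ᵐ_
  infixr 4 _∧ᵐ_
  infixr 3 _⇒ᵐ_

  data ModalForm : Set where
    atom  : P → ModalForm
    ¬ᵐ_   : ModalForm → ModalForm
    _∧ᵐ_  : ModalForm → ModalForm → ModalForm
    _⇒ᵐ_  : ModalForm → ModalForm → ModalForm
    □ᵐ    : Agent → ModalForm → ModalForm
    ⋀ᵐ    : (n : ℕ) → (Fin n → ModalForm) → ModalForm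

  _,_⊨ᵐ_ : (M : KStruct) → St M → ModalForm → Set
  M , w ⊨ᵐ atom p   = V M p w
  M , w ⊨ᵐ (¬ᵐ χ)   = ¬ (M , w ⊨ᵐ χ)
  M , w ⊨ᵐ (χ ∧ᵐ ξ) = (M , w ⊨ᵐ χ) × (M , w ⊨ᵐ ξ)
  M , w ⊨ᵐ (χ ⇒ᵐ ξ) = M , w ⊨ᵐ χ → M , w ⊨ᵐ ξ
  M , w ⊨ᵐ □ᵐ a χ   = ∀ v → R M a w v → M , v ⊨ᵐ χ
  M , w ⊨ᵐ ⋀ᵐ n χs  = ∀ i → M , w ⊨ᵐ χs i

  ⊤ᵐ : ModalForm
  ⊤ᵐ = ⋀ᵐ 0 (λ ())

  when : Bool → ModalForm → ModalForm
  when true  χ = χ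
  when false χ = ⊤ᵐ

  ⊨ᵐ-when : ∀ {M w} b χ → M , w ⊨ᵐ when b χ ⇔ (b ≡ true → M , w ⊨ᵐ χ)
  ⊨ᵐ-when true  χ = mk⇔ (λ χ-holds _ → χ-holds) (λ f → f refl)
  ⊨ᵐ-when false χ = mk⇔ (λ _ ()) (λ _ ())

  module Reduction {k : ℕ} (rel : Agent → Fin (suc k) → Fin (suc k) → Bool)
                   (pre : Fin (suc k) → ModalForm) where

    reduct : Fin (suc k) → ModalForm → ModalForm
    reduct e (atom p)  = atom p
    reduct e (¬ᵐ χ)    = ¬ᵐ reduct e χ
    reduct e (χ ∧ᵐ ξ)  = reduct e χ ∧ᵐ reduct e ξ
    reduct e (χ ⇒ᵐ ξ)  = reduct e χ ⇒ᵐ reduct e ξ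
    reduct e (□ᵐ a χ)  = ⋀ᵐ (suc k) (λ f → when (rel a e f) (□ᵐ a (pre f ⇒ᵐ reduct f χ)))
    reduct e (⋀ᵐ n χs) = ⋀ᵐ n (λ i → reduct e (χs i))

    after : Fin (suc k) → ModalForm → ModalForm
    after e χ = pre e ⇒ᵐ reduct e χ

    module _ (pr : Fin (suc k) → Form) (T : Subset (suc k)) (M : KStruct)
             (pre-correct : ∀ v e → M , v ⊨ᵐ pre e ⇔ M , v ⊨ pr e) where

      A : SAM
      A = toSAM (actionModel rel pr) T

      mutual
        reduct-correct : ∀ {w e} χ (h : M , w ⊨ pr e) →
                         M , w ⊨ᵐ reduct e χ ⇔ exec M A , ((w , e) , h) ⊨ᵐ χ
        reduct-correct (atom p)  h = ⇔-id _
        reduct-correct (¬ᵐ χ)    h = ¬-cong-⇔ (reduct-correct χ h)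
        reduct-correct (χ ∧ᵐ ξ)  h = reduct-correct χ h ×-⇔ reduct-correct ξ h
        reduct-correct (χ ⇒ᵐ ξ)  h = →-cong-⇔ (reduct-correct χ h) (reduct-correct ξ h)
        reduct-correct (□ᵐ a χ)  h = reduct-□-correct a χ h
        reduct-correct (⋀ᵐ n χs) h = Π-cong-⇔ (λ i → reduct-correct (χs i) h)

        after-correct : ∀ {w e} χ →
                        M , w ⊨ᵐ after e χ ⇔ (∀ h → exec M A , ((w , e) , h) ⊨ᵐ χ)
        after-correct {w} {e} χ = →-Π-cong-⇔ (pre-correct w e) (reduct-correct χ)

        reduct-□-correct : ∀ {w e} a χ (h : M , w ⊨ pr e) →
                           M , w ⊨ᵐ reduct e (□ᵐ a χ) ⇔ exec M A , ((w , e) , h) ⊨ᵐ □ᵐ a χ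
        reduct-□-correct {w} {e} a χ _ = mk⇔
          (λ holds → λ { ((v , f) , h′) (wRv , e→f) →
              to (after-correct χ) (to (⊨ᵐ-when (rel a e f) _) (holds f) e→f v wRv) h′ })
          (λ holds f → from (⊨ᵐ-when (rel a e f) _) (λ e→f v wRv →
              from (after-correct χ) (λ h′ → holds ((v , f) , h′) (wRv , e→f))))

  translate : Form → ModalForm
  translate (atom p)  = atom p
  translate (¬ᶠ φ)    = ¬ᵐ translate φ
  translate (φ ∧ᶠ ψ)  = translate φ ∧ᵐ translate ψ
  translate (□ a φ)   = □ᵐ a (translate φ)
  translate ([_,_]_ {k} (actionModel rel pr) T φ) =
    ⋀ᵐ (suc k) (λ e → when (lookup T e) (after e (translate φ)))
    where open Reduction rel (translate ∘ pr)

  translate-correct : ∀ φ M w → M , w ⊨ φ ⇔ M , w ⊨ᵐ translate φ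
  translate-correct (atom p) M w = ⇔-id _
  translate-correct (¬ᶠ φ)   M w = ¬-cong-⇔ (translate-correct φ M w)
  translate-correct (φ ∧ᶠ ψ) M w = translate-correct φ M w ×-⇔ translate-correct ψ M w
  translate-correct (□ a φ)  M w =
    Π-cong-⇔ (λ v → →-cong-⇔ (⇔-id _) (translate-correct φ M v))
  translate-correct ([_,_]_ {k} (actionModel rel pr) T φ) M w = Π-cong-⇔ λ e →
    ⇔-trans (→-cong-⇔ (mk⇔ []=⇒lookup (lookup⇒[]= e T))
                      (⇔-trans (Π-cong-⇔ λ h → translate-correct φ (exec M A) ((w , e) , h))
                               (⇔-sym (after-correct pr T M pre-correct (translate φ)))))
            (⇔-sym (⊨ᵐ-when (lookup T e) _))
    where
      open Reduction rel (translate ∘ pr) using (after-correct)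
      A : SAM
      A = toSAM (actionModel rel pr) T
      pre-correct : ∀ v f → M , v ⊨ᵐ translate (pr f) ⇔ M , v ⊨ pr f
      pre-correct v f = ⇔-sym (translate-correct (pr f) M v)

  module _ (p₀ : P) where

    ⊤ᶠ : AForm
    ⊤ᶠ = ¬ᶠ (atom p₀ ∧ᶠ (¬ᶠ atom p₀))

    ⋀ᶠ : (n : ℕ) → (Fin n → AForm) → AForm
    ⋀ᶠ zero    ψs = ⊤ᶠ
    ⋀ᶠ (suc n) ψs = ψs zero ∧ᶠ ⋀ᶠ n (ψs ∘ suc)

    ⊨ᶠ-⋀ᶠ : ∀ {M w} n ψs → M , w ⊨ᶠ ⋀ᶠ n ψs ⇔ (∀ i → M , w ⊨ᶠ ψs i)
    ⊨ᶠ-⋀ᶠ zero    ψs = mk⇔ (λ _ ()) (λ _ (p , ¬p) → ¬p p)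
    ⊨ᶠ-⋀ᶠ (suc n) ψs = mk⇔
      (λ { (ψ₀ , ψs-hold) zero    → ψ₀
         ; (ψ₀ , ψs-hold) (suc i) → to (⊨ᶠ-⋀ᶠ n (ψs ∘ suc)) ψs-hold i })
      (λ ψs-hold → ψs-hold zero , from (⊨ᶠ-⋀ᶠ n (ψs ∘ suc)) (ψs-hold ∘ suc))

    embed : ModalForm → AForm
    embed (atom p)  = atom p
    embed (¬ᵐ χ)    = ¬ᶠ embed χ
    embed (χ ∧ᵐ ξ)  = embed χ ∧ᶠ embed ξ
    embed (χ ⇒ᵐ ξ)  = ¬ᶠ (embed χ ∧ᶠ (¬ᶠ embed ξ))
    embed (□ᵐ a χ)  = □ a (embed χ)
    embed (⋀ᵐ n χs) = ⋀ᶠ n (embed ∘ χs)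

    embed-correct : ExcludedMiddle 0ℓ → ∀ χ M w → M , w ⊨ᵐ χ ⇔ M , w ⊨ᶠ embed χ
    embed-correct em (atom p)  M w = ⇔-id _
    embed-correct em (¬ᵐ χ)    M w = ¬-cong-⇔ (embed-correct em χ M w)
    embed-correct em (χ ∧ᵐ ξ)  M w = embed-correct em χ M w ×-⇔ embed-correct em ξ M w
    embed-correct em (χ ⇒ᵐ ξ)  M w =
      ⇔-trans (→-cong-⇔ (embed-correct em χ M w) (embed-correct em ξ M w))
              (stable⇒→⇔¬×¬ (decidable-stable em))
    embed-correct em (□ᵐ a χ)  M w =
      Π-cong-⇔ (λ v → →-cong-⇔ (⇔-id _) (embed-correct em χ M v))
    embed-correct em (⋀ᵐ n χs) M w =
      ⇔-trans (Π-cong-⇔ (λ i → embed-correct em (χs i) M w)) (⇔-sym (⊨ᶠ-⋀ᶠ n (embed ∘ χs)))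

corollary6p5 : ExcludedMiddle 0ℓ → (nA : ℕ) → (P : Set) → P ↣ ℕ → P →
    (φ : Logic.Form nA P) →
    Σ (Logic.AForm nA P) (λ φ' →
      (M : Logic.KStruct nA P) → (w : Logic.St M) →
        (Logic._,_⊨_ nA P M w φ ⇔ Logic._,_⊨ᶠ_ nA P M w φ'))
corollary6p5 em nA P _ p₀ φ =
  embed nA P p₀ (translate nA P φ) , λ M w →
    ⇔-trans (translate-correct nA P φ M w) (embed-correct nA P p₀ em (translate nA P φ) M w)
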